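{- Identify each of the following sequent calculus and cirquent calculus systems with the set of formulas it proves. Then (1) Affine logic $= \mathbf{CL5}^* \subseteq \mathbf{CL5}$, and $\mathbf{CL5}\neq$ Affine logic; (2) Classical logic $= \mathbf{CCC}^*\subseteq \mathbf{CCC} =$ Classical logic.
   Context: Formulas: built from infinitely many propositional atoms (no constants) using $\neg,\wedge,\vee$ (binary), with $\neg$ applied only to atoms; $\neg\neg F$, $\neg(F\wedge G)$, $\neg(F\vee G)$, $F\to G$ abbreviate $F$, $\neg F\vee\neg G$, $\neg F\wedge\neg G$, $\neg F\vee G$. Sequent calculus: a sequent is a nonempty finite sequence of formulas. Rules ($\Gamma,\Delta$ possibly empty sequences): Axiom $\neg F,F$; Exchange: $\Gamma,F,G,\Delta \Rightarrow \Gamma,G,F,\Delta$; Weakening: $\Gamma,\Delta\Rightarrow\Gamma,F,\Delta$; Contraction: $\Gamma,F,F,\Delta\Rightarrow\Gamma,F,\Delta$; $\vee$-introduction: $\Gamma,F,G,\Delta\Rightarrow\Gamma,F\vee G,\Delta$; $\wedge$-introduction: from $\Gamma,F$ and $G,\Delta$ infer $\Gamma,F\wedge G,\Delta$. Classical logic is the system with all six rules; Affine logic is all rules except Contraction. Provability via finite proof trees; a formula is provable iff the one-element sequent is. Cirquents: a $k$-ary pool is a sequence $\langle F_1,\dots,F_k\rangle$ of formulas (entries called oformulas; repetitions allowed). A $k$-ary structure is a finite sequence $\langle\Gamma_1,\dots,\Gamma_m\rangle$ ($m\ge0$, repetitions allowed) of subsets of $\{1,\dots,k\}$ (entries called ogroups);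 ogroup $\Gamma$ contains the oformulas $F_i$, $i\in\Gamma$. A $k$-ary cirquent is a pair (structure, pool) of a $k$-ary structure and a $k$-ary pool. A formula $F$ is identified with the cirquent $(\langle\{1\}\rangle,\langle F\rangle)$. Cirquent calculus rules: (A) Axioms: the empty cirquent $(\langle\rangle,\langle\rangle)$, and $(\langle\{1,2\}\rangle,\langle\neg F,F\rangle)$ for every formula $F$. (M) Mix: from $(\langle\Gamma_1,\dots,\Gamma_m\rangle,\langle F_1,\dots,F_k\rangle)$ and $(\langle\Delta_1,\dots,\Delta_n\rangle,\langle G_1,\dots,G_l\rangle)$ infer $(\langle\Gamma_1,\dots,\Gamma_m,\Delta_1+k,\dots,\Delta_n+k\rangle,\langle F_1,\dots,F_k,G_1,\dots,G_l\rangle)$, where $\Delta+k=\{j+k:j\in\Delta\}$. (E) Exchange: either swap two adjacent oformulas of the pool, redirecting indices so every ogroup contains the same oformulas as before; or swap two adjacent ogroups of the structure. (W) Weakening: either add to one ogroup the index of an existing oformula; or insert a new formula anywhere in the pool, renumbering so every ogroup contains the same oformulas as before. (D) Duplication: replace an ogroup $\Gamma$ by two adjacent ogroups $\Gamma,\Gamma$ (downward), or replace two adjacent ogroups equal as sets by one copy (upward). (C) Contraction: replace two adjacent oformulas that are the same formula $F$ by a single oformula $F$, each ogroup that contained either of them now containing the new one. ($\vee$) $\vee$-introduction: replace two adjacent oformulas $F,G$ by a single oformula $F\vee G$; an ogroup contains the new oformula iff it contained $F$ or $G$. ($\wedge$) $\wedge$-introduction: applicable when for adjacent oformulas $F,G$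 no ogroup contains both, every ogroup containing $F$ is immediately followed in the structure by an ogroup containing $G$, and every ogroup containing $G$ is immediately preceded by an ogroup containing $F$; the conclusion replaces each such pair of adjacent ogroups by their union and then replaces $F,G$ by a single oformula $F\wedge G$ (as in $\vee$-introduction). A proof of a cirquent in a cirquent calculus system (a set of these rules) is a finite tree of cirquents with that cirquent at the root, each node following from its children by a rule of the system. $\mathbf{CCC}$ is the system with all eight rules (A, M, E, W, D, C, $\vee$, $\wedge$); $\mathbf{CL5}$ is all rules except Contraction. A cirquent is primitive iff its ogroups are pairwise disjoint. For a system $S$, $S^*$ is the system whose proofs are the proofs of $S$ in which every cirquent is primitive. -}

module Defs where

open import Data.Nat using (ℕ; zero; suc; _+_)
open import Data.Bool using (Bool; true; false; _∨_)
open import Data.Unit using (⊤)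
open import Data.Product using (_×_; _,_; proj₁; proj₂)
open import Data.List using (List; []; _∷_; map) renaming (_++_ to _++ˡ_)
open import Data.List.Relation.Unary.AllPairs using (AllPairs)
open import Data.Vec using (Vec; []; _∷_; _++_; replicate; insertAt)
open import Data.Fin using (Fin)
open import Data.Fin.Subset using (Subset; _∪_; _∩_; ⁅_⁆; Empty)
open import Relation.Binary.PropositionalEquality using (_≡_)
open import Function.Bundles using (_⇔_)
open import Relation.Nullary using (¬_)

infixr 6 _∧ᶠ_
infixr 5 _∨ᶠ_

data Formula : Set where
  atom    : ℕ → Formula
  negatom : ℕ → Formula
  _∧ᶠ_    : Formula → Formula → Formula
  _∨ᶠ_    : Formula → Formula → Formula

~_ : Formula → Formula
~ atom n    = negatom n
~ negatom n = atom n
~ (F ∧ᶠ G)  = (~ F) ∨ᶠ (~ G)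
~ (F ∨ᶠ G)  = (~ F) ∧ᶠ (~ G)

data SeqProof (withContraction : Bool) : List Formula → Set where
  axiom : ∀ F → SeqProof withContraction (~ F ∷ F ∷ [])
  exch  : ∀ Γ F G Δ → SeqProof withContraction (Γ ++ˡ (F ∷ G ∷ Δ))
                    → SeqProof withContraction (Γ ++ˡ (G ∷ F ∷ Δ))
  weak  : ∀ Γ F Δ → SeqProof withContraction (Γ ++ˡ Δ)
                  → SeqProof withContraction (Γ ++ˡ (F ∷ Δ))
  contr : ∀ Γ F Δ → withContraction ≡ true
                  → SeqProof withContraction (Γ ++ˡ (F ∷ F ∷ Δ))
                  → SeqProof withContraction (Γ ++ˡ (F ∷ Δ))
  ∨-intro : ∀ Γ F G Δ → SeqProof withContraction (Γ ++ˡ (F ∷ G ∷ Δ))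
                      → SeqProof withContraction (Γ ++ˡ ((F ∨ᶠ G) ∷ Δ))
  ∧-intro : ∀ Γ F G Δ → SeqProof withContraction (Γ ++ˡ (F ∷ []))
                      → SeqProof withContraction (G ∷ Δ)
                      → SeqProof withContraction (Γ ++ˡ ((F ∧ᶠ G) ∷ Δ))

ClassicalLogic : Formula → Set
ClassicalLogic F = SeqProof true (F ∷ [])

AffineLogic : Formula → Set
AffineLogic F = SeqProof false (F ∷ [])

-- Cirquents.  A k-ary pool is a `Vec Formula k`; a k-ary ogroup is a
-- subset of the k positions, `Subset k` (= Vec Bool k); a k-ary
-- structure is a `List (Subset k)`.

pairAt : ∀ {A : Set} a {b} → Vec A (a + (2 + b)) → A × A
pairAt zero    (x ∷ y ∷ _) = x , y
pairAt (suc a) (_ ∷ v)     = pairAt a v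

swapAt : ∀ {A : Set} a {b} → Vec A (a + (2 + b)) → Vec A (a + (2 + b))
swapAt zero    (x ∷ y ∷ v) = y ∷ x ∷ v
swapAt (suc a) (x ∷ v)     = x ∷ swapAt a v

mergeAt : ∀ {A : Set} a {b} → (A → A → A) → Vec A (a + (2 + b)) → Vec A (a + suc b)
mergeAt zero    f (x ∷ y ∷ v) = f x y ∷ v
mergeAt (suc a) f (x ∷ v)     = x ∷ mergeAt a f v

first : Formula → Formula → Formula
first F _ = F

Primitive : ∀ {k} → List (Subset k) → Set
Primitive Γs = AllPairs (λ Γ Δ → Empty (Γ ∩ Δ)) Γs

Ok : Bool → ∀ {k} → List (Subset k) → Set
Ok false Γs = ⊤
Ok true  Γs = Primitive Γs

-- JoinAt a Γs Γs' : the ∧-introduction side conditions for the oformulas at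
-- positions a, a+1 (call them F, G) hold in structure Γs, and Γs' is Γs with
-- each adjacent pair (ogroup containing F, ogroup containing G) replaced by
-- its union.  No ogroup may contain both; every F-ogroup must be immediately
-- followed by a G-ogroup and every G-ogroup immediately preceded by an F-ogroup.
data JoinAt (a : ℕ) {b : ℕ} : List (Subset (a + (2 + b))) → List (Subset (a + (2 + b))) → Set where
  jnil  : JoinAt a [] []
  jskip : ∀ {Γ Γs Γs'} → pairAt a Γ ≡ (false , false)
        → JoinAt a Γs Γs' → JoinAt a (Γ ∷ Γs) (Γ ∷ Γs')
  jpair : ∀ {Γ Δ Γs Γs'} → pairAt a Γ ≡ (true , false) → pairAt a Δ ≡ (false , true)
        → JoinAt a Γs Γs' → JoinAt a (Γ ∷ Δ ∷ Γs) ((Γ ∪ Δ) ∷ Γs')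

-- CirqProof withContraction star k structure pool.
--   withContraction = true : CCC ; false : CL5.
--   star = true : the S* variant (every cirquent in the proof is primitive).
data CirqProof (withContraction star : Bool) : (k : ℕ) → List (Subset k) → Vec Formula k → Set where
  axEmpty : Ok star {0} [] → CirqProof withContraction star 0 [] []
  axNeg   : ∀ F → Ok star {2} ((true ∷ true ∷ []) ∷ [])
          → CirqProof withContraction star 2 ((true ∷ true ∷ []) ∷ []) (~ F ∷ F ∷ [])
  mix : ∀ {k l Γs Δs} {P : Vec Formula k} {Q : Vec Formula l}
      → CirqProof withContraction star k Γs P → CirqProof withContraction star l Δs Q
      → Ok star (map (λ Γ → Γ ++ replicate l false) Γs ++ˡ map (λ Δ → replicate k false ++ Δ) Δs)
      → CirqProof withContraction star (k + l)
          (map (λ Γ → Γ ++ replicate l false) Γs ++ˡ map (λ Δ → replicate k false ++ Δ) Δs)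
          (P ++ Q)
  exchF : ∀ a {b Γs} {P : Vec Formula (a + (2 + b))}
        → CirqProof withContraction star _ Γs P
        → Ok star (map (swapAt a) Γs)
        → CirqProof withContraction star _ (map (swapAt a) Γs) (swapAt a P)
  exchG : ∀ {k} Γs Γ Δ Δs {P : Vec Formula k}
        → CirqProof withContraction star k (Γs ++ˡ (Γ ∷ Δ ∷ Δs)) P
        → Ok star (Γs ++ˡ (Δ ∷ Γ ∷ Δs))
        → CirqProof withContraction star k (Γs ++ˡ (Δ ∷ Γ ∷ Δs)) P
  weakG : ∀ {k} Γs Γ Δs (i : Fin k) {P : Vec Formula k}
        → CirqProof withContraction star k (Γs ++ˡ (Γ ∷ Δs)) P
        → Ok star (Γs ++ˡ ((⁅ i ⁆ ∪ Γ) ∷ Δs))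
        → CirqProof withContraction star k (Γs ++ˡ ((⁅ i ⁆ ∪ Γ) ∷ Δs)) P
  weakF : ∀ {k Γs} {P : Vec Formula k} (i : Fin (suc k)) F
        → CirqProof withContraction star k Γs P
        → Ok star (map (λ Γ → insertAt Γ i false) Γs)
        → CirqProof withContraction star (suc k) (map (λ Γ → insertAt Γ i false) Γs) (insertAt P i F)
  dupDown : ∀ {k} Γs Γ Δs {P : Vec Formula k}
          → CirqProof withContraction star k (Γs ++ˡ (Γ ∷ Δs)) P
          → Ok star (Γs ++ˡ (Γ ∷ Γ ∷ Δs))
          → CirqProof withContraction star k (Γs ++ˡ (Γ ∷ Γ ∷ Δs)) P
  dupUp : ∀ {k} Γs Γ Δs {P : Vec Formula k}
        → CirqProof withContraction star k (Γs ++ˡ (Γ ∷ Γ ∷ Δs)) P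
        → Ok star (Γs ++ˡ (Γ ∷ Δs))
        → CirqProof withContraction star k (Γs ++ˡ (Γ ∷ Δs)) P
  contr : ∀ a {b Γs} {P : Vec Formula (a + (2 + b))}
        → withContraction ≡ true
        → proj₁ (pairAt a P) ≡ proj₂ (pairAt a P)
        → CirqProof withContraction star _ Γs P
        → Ok star (map (mergeAt a _∨_) Γs)
        → CirqProof withContraction star _ (map (mergeAt a _∨_) Γs) (mergeAt a first P)
  ∨-intro : ∀ a {b Γs} {P : Vec Formula (a + (2 + b))}
          → CirqProof withContraction star _ Γs P
          → Ok star (map (mergeAt a _∨_) Γs)
          → CirqProof withContraction star _ (map (mergeAt a _∨_) Γs) (mergeAt a _∨ᶠ_ P)
  ∧-intro : ∀ a {b Γs Γs'} {P : Vec Formula (a + (2 + b))}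
          → CirqProof withContraction star _ Γs P
          → JoinAt a Γs Γs'
          → Ok star (map (mergeAt a _∨_) Γs')
          → CirqProof withContraction star _ (map (mergeAt a _∨_) Γs') (mergeAt a _∧ᶠ_ P)

CirqProves : Bool → Bool → Formula → Set
CirqProves c s F = CirqProof c s 1 ((true ∷ []) ∷ []) (F ∷ [])

CCC CCC* CL5 CL5* : Formula → Set
CCC  = CirqProves true  false
CCC* = CirqProves true  true
CL5  = CirqProves false false
CL5* = CirqProves false true

_≐_ : (Formula → Set) → (Formula → Set) → Set
S ≐ T = ∀ F → (S F ⇔ T F)

_⊑_ : (Formula → Set) → (Formula → Set) → Set
S ⊑ T = ∀ F → S F → T F

module Submission where

-- Every ogroup of a cirquent derivable in CCC, CCC* or CL5* lists the formulas of a derivable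
-- sequent: the cirquent rules act on each ogroup like the corresponding sequent rules, except that
-- ∧-introduction unites two ogroups, and the oformulas they share must be contracted away, unless
-- the cirquent is primitive and they share none. Conversely, each sequent rule is simulated on the
-- one-ogroup cirquent of its sequent without leaving primitive cirquents. CL5 nevertheless proves
-- Blass's formula, which a six-element model of affine logic refutes.

open import Defs
open import Algebra.Bundles using (CommutativeSemigroup)
open import Algebra.Definitions using (RightZero; Involutive)
open import Algebra.Structures using (IsCommutativeMonoid)
open import Data.Bool using (Bool; true; false; _∨_)
open import Data.Fin using (Fin; zero; suc; fromℕ; _↑ˡ_)
open import Data.Fin.Properties using (all?; _≟_)
open import Data.Fin.Subset using (Subset; ⊤; ⊥; _∪_; _∩_; _∈_; ⁅_⁆; Empty) renaming (_⊆_ to _⊆ₛ_)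
open import Data.Fin.Subset.Properties
  using (drop-∷-⊆; drop-∷-Empty; Empty-unique; ∉⊥; p∩q⊆p; p⊆p∪q; q⊆p∪q; ∪-identityˡ; ∩-zeroˡ)
open import Data.List as List using (List; []; _∷_; [_]; _++_)
open import Data.List.Properties using (++-assoc; ++-identityʳ; map-injective)
open import Data.List.Relation.Binary.Permutation.Propositional as ↭
  using (_↭_; prep; swap; ↭-refl; ↭-sym; ↭-trans; module PermutationReasoning)
open import Data.List.Relation.Binary.Permutation.Propositional.Properties using (++⁺ˡ; shift; ∷↭∷ʳ)
open import Data.List.Relation.Binary.Sublist.Propositional using (_⊆_; []; _∷_; _∷ʳ_)
import Data.List.Relation.Binary.Sublist.Propositional.Properties as Sublist
open import Data.List.Relation.Unary.All as All using (All; []; _∷_)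
open import Data.List.Relation.Unary.All.Properties using (map⁺; ++⁺; ++⁻)
open import Data.List.Relation.Unary.AllPairs as AllPairs using ([]; _∷_)
open import Data.Nat using (ℕ; zero; suc; _+_)
open import Data.Product using (_×_; _,_; uncurry)
open import Data.Sum using (_⊎_; inj₁; inj₂; map₂)
import Data.Unit as Unit
open import Data.Vec using (Vec; []; _∷_; here; there; replicate; insertAt; splitAt; toList; fromList)
  renaming (_++_ to _++ᵛ_)
open import Data.Vec.Properties
  using (toList-++; toList∘fromList; length-toList; toList-injective; zipWith-++; cast-is-id)
open import Function using (_∘_)
open import Function.Bundles using (mk⇔; Equivalence)
open import Relation.Binary.PropositionalEquality
  using (_≡_; refl; sym; trans; cong; cong₂; subst; subst₂; isMagma; module ≡-Reasoning)
open import Relation.Nullary using (¬_)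
open import Relation.Nullary.Decidable using (from-yes; _→-dec_)

private
  variable
    k s : Bool
    m n : ℕ
    A : Set
    Γ Δ Θ Λ : List Formula

reassocˡ : ∀ Θ Λ → SeqProof k (Θ ++ Λ ++ Γ) → SeqProof k ((Θ ++ Λ) ++ Γ)
reassocˡ Θ Λ = subst (SeqProof _) (sym (++-assoc Θ Λ _))

reassocʳ : ∀ Θ Λ → SeqProof k ((Θ ++ Λ) ++ Γ) → SeqProof k (Θ ++ Λ ++ Γ)
reassocʳ Θ Λ = subst (SeqProof _) (++-assoc Θ Λ _)

SeqProof-resp-↭ : Γ ↭ Δ → SeqProof k Γ → SeqProof k Δ
SeqProof-resp-↭ = go []
  where
  go : ∀ Θ → Γ ↭ Δ → SeqProof k (Θ ++ Γ) → SeqProof k (Θ ++ Δ)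
  go Θ ↭.refl         ⊢ = ⊢
  go Θ (prep x p)     ⊢ = reassocʳ Θ [ x ] (go (Θ ++ [ x ]) p (reassocˡ Θ [ x ] ⊢))
  go Θ (swap x y p)   ⊢ = reassocʳ Θ (y ∷ x ∷ []) (go (Θ ++ y ∷ x ∷ []) p (reassocˡ Θ (y ∷ x ∷ []) (exch Θ x y _ ⊢)))
  go Θ (↭.trans p q)  ⊢ = go Θ q (go Θ p ⊢)

weaken-⊆ : Γ ⊆ Δ → SeqProof k Γ → SeqProof k Δ
weaken-⊆ = go []
  where
  go : ∀ Θ → Γ ⊆ Δ → SeqProof k (Θ ++ Γ) → SeqProof k (Θ ++ Δ)
  go Θ []         ⊢ = ⊢
  go Θ (y ∷ʳ σ)   ⊢ = weak Θ y _ (go Θ σ ⊢)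
  go Θ (_∷_ {x = x} refl σ) ⊢ = reassocʳ Θ [ x ] (go (Θ ++ [ x ]) σ (reassocˡ Θ [ x ] ⊢))

contract-⊆ : Δ ⊆ Γ → SeqProof true (Γ ++ Δ) → SeqProof true Γ
contract-⊆ = go []
  where
  go : ∀ Θ → Δ ⊆ Γ → SeqProof true (Θ ++ Γ ++ Δ) → SeqProof true (Θ ++ Γ)
  go Θ []       ⊢ = ⊢
  go Θ (y ∷ʳ σ) ⊢ = reassocʳ Θ [ y ] (go (Θ ++ [ y ]) σ (reassocˡ Θ [ y ] ⊢))
  go Θ (_∷_ {x = x} {xs = Δ} {ys = Γ} refl σ) ⊢ =
    reassocʳ Θ [ x ] (go (Θ ++ [ x ]) σ (reassocˡ Θ [ x ]
      (contr Θ x _ refl (SeqProof-resp-↭ (++⁺ˡ Θ (prep x (shift x Γ Δ))) ⊢))))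

∧-intro-inside : ∀ {F G} → SeqProof k (Γ ++ F ∷ Δ) → SeqProof k (Θ ++ G ∷ Λ) →
                 SeqProof k ((F ∧ᶠ G) ∷ (Γ ++ Δ) ++ Θ ++ Λ)
∧-intro-inside {Γ = Γ} {Δ} {Θ} {Λ} {F} {G} ⊢F ⊢G =
  SeqProof-resp-↭ (shift (F ∧ᶠ G) (Γ ++ Δ) (Θ ++ Λ))
    (∧-intro (Γ ++ Δ) F G (Θ ++ Λ)
      (SeqProof-resp-↭ (↭-trans (shift F Γ Δ) (∷↭∷ʳ F (Γ ++ Δ))) ⊢F)
      (SeqProof-resp-↭ (shift G Θ Λ) ⊢G))

-- Ogroups as sequents

oformulas : Subset n → Vec Formula n → List Formula
oformulas []          []      = []
oformulas (true ∷ g)  (F ∷ P) = F ∷ oformulas g P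
oformulas (false ∷ g) (_ ∷ P) = oformulas g P

oformulas-++ : ∀ (u : Subset m) (U : Vec Formula m) {v : Subset n} {V} →
               oformulas (u ++ᵛ v) (U ++ᵛ V) ≡ oformulas u U ++ oformulas v V
oformulas-++ []          []      = refl
oformulas-++ (true ∷ u)  (F ∷ U) = cong (F ∷_) (oformulas-++ u U)
oformulas-++ (false ∷ u) (_ ∷ U) = oformulas-++ u U

oformulas-⊥ : (P : Vec Formula n) → oformulas ⊥ P ≡ []
oformulas-⊥ []      = refl
oformulas-⊥ (_ ∷ P) = oformulas-⊥ P

oformulas-padʳ : ∀ (g : Subset m) (P : Vec Formula m) {Q : Vec Formula n} →
                 oformulas (g ++ᵛ ⊥) (P ++ᵛ Q) ≡ oformulas g P
oformulas-padʳ g P {Q} = trans (oformulas-++ g P) (trans (cong (oformulas g P ++_) (oformulas-⊥ Q)) (++-identityʳ _))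

oformulas-padˡ : ∀ (d : Subset n) (P : Vec Formula m) {Q : Vec Formula n} →
                 oformulas (⊥ ++ᵛ d) (P ++ᵛ Q) ≡ oformulas d Q
oformulas-padˡ d P = trans (oformulas-++ ⊥ P) (cong (_++ _) (oformulas-⊥ P))

oformulas-insertAt : ∀ (g : Subset n) P (i : Fin (suc n)) {F} →
                     oformulas (insertAt g i false) (insertAt P i F) ≡ oformulas g P
oformulas-insertAt g           P       zero    = refl
oformulas-insertAt (true ∷ g)  (G ∷ P) (suc i) = cong (G ∷_) (oformulas-insertAt g P i)
oformulas-insertAt (false ∷ g) (_ ∷ P) (suc i) = oformulas-insertAt g P i

oformulas-mono : ∀ {g d : Subset n} {P} → g ⊆ₛ d → oformulas g P ⊆ oformulas d P
oformulas-mono {g = []}        {[]}        {[]}    _   = []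
oformulas-mono {g = true ∷ g}  {true ∷ d}  {F ∷ P} g⊆d = refl ∷ oformulas-mono (drop-∷-⊆ g⊆d)
oformulas-mono {g = true ∷ g}  {false ∷ d} {F ∷ P} g⊆d with g⊆d here
... | ()
oformulas-mono {g = false ∷ g} {true ∷ d}  {F ∷ P} g⊆d = F ∷ʳ oformulas-mono (drop-∷-⊆ g⊆d)
oformulas-mono {g = false ∷ g} {false ∷ d} {F ∷ P} g⊆d = oformulas-mono (drop-∷-⊆ g⊆d)

oformulas-∪-∩ : ∀ (g d : Subset n) P →
                oformulas g P ++ oformulas d P ↭ oformulas (g ∪ d) P ++ oformulas (g ∩ d) P
oformulas-∪-∩ []          []          []      = ↭-refl
oformulas-∪-∩ (true ∷ g)  (true ∷ d)  (F ∷ P) = begin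
  F ∷ oformulas g P ++ F ∷ oformulas d P              ↭⟨ prep F (shift F _ _) ⟩
  F ∷ F ∷ oformulas g P ++ oformulas d P               ↭⟨ prep F (prep F (oformulas-∪-∩ g d P)) ⟩
  F ∷ F ∷ oformulas (g ∪ d) P ++ oformulas (g ∩ d) P   ↭⟨ prep F (shift F _ _) ⟨
  F ∷ oformulas (g ∪ d) P ++ F ∷ oformulas (g ∩ d) P   ∎
  where open PermutationReasoning
oformulas-∪-∩ (true ∷ g)  (false ∷ d) (F ∷ P) = prep F (oformulas-∪-∩ g d P)
oformulas-∪-∩ (false ∷ g) (true ∷ d)  (F ∷ P) = ↭-trans (shift F _ _) (prep F (oformulas-∪-∩ g d P))
oformulas-∪-∩ (false ∷ g) (false ∷ d) (_ ∷ P) = oformulas-∪-∩ g d P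

∪-admissible : ∀ Θ (g d : Subset n) P → k ≡ true ⊎ Empty (g ∩ d) →
               SeqProof k (Θ ++ oformulas g P ++ oformulas d P) → SeqProof k (Θ ++ oformulas (g ∪ d) P)
∪-admissible Θ g d P contr-or-disjoint ⊢ =
  drop-shared contr-or-disjoint (reassocˡ Θ _ (SeqProof-resp-↭ (++⁺ˡ Θ (oformulas-∪-∩ g d P)) ⊢))
  where
  drop-shared : k ≡ true ⊎ Empty (g ∩ d) →
                SeqProof k ((Θ ++ oformulas (g ∪ d) P) ++ oformulas (g ∩ d) P) → SeqProof k (Θ ++ oformulas (g ∪ d) P)
  drop-shared (inj₁ refl) = contract-⊆ (Sublist.++⁺ˡ Θ (oformulas-mono (λ x∈g∩d → p⊆p∪q d (p∩q⊆p g d x∈g∩d))))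
  drop-shared (inj₂ disjoint) ⊢ =
    subst (SeqProof _) (++-identityʳ _) (subst (λ Λ → SeqProof _ ((Θ ++ oformulas (g ∪ d) P) ++ Λ)) none-shared ⊢)
    where
    none-shared : oformulas (g ∩ d) P ≡ []
    none-shared = trans (cong (λ e → oformulas e P) (Empty-unique disjoint)) (oformulas-⊥ P)

data Split {A : Set} (a : ℕ) {b : ℕ} : Vec A (a + (2 + b)) → Set where
  split : (u : Vec A a) (x y : A) (w : Vec A b) → Split a (u ++ᵛ x ∷ y ∷ w)

splitAt₂ : ∀ a {b} (v : Vec A (a + (2 + b))) → Split a v
splitAt₂ a v with splitAt a v
... | u , x ∷ y ∷ w , refl = split u x y w

pairAt-++ : ∀ {a b} (u : Vec A a) {x y} {w : Vec A b} → pairAt a (u ++ᵛ x ∷ y ∷ w) ≡ (x , y)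
pairAt-++ []      = refl
pairAt-++ (_ ∷ u) = pairAt-++ u

swapAt-++ : ∀ {a b} (u : Vec A a) {x y} {w : Vec A b} → swapAt a (u ++ᵛ x ∷ y ∷ w) ≡ u ++ᵛ y ∷ x ∷ w
swapAt-++ []      = refl
swapAt-++ (z ∷ u) = cong (z ∷_) (swapAt-++ u)

mergeAt-++ : ∀ {a b} (u : Vec A a) {f : A → A → A} {x y} {w : Vec A b} →
             mergeAt a f (u ++ᵛ x ∷ y ∷ w) ≡ u ++ᵛ f x y ∷ w
mergeAt-++ []      = refl
mergeAt-++ (z ∷ u) = cong (z ∷_) (mergeAt-++ u)

oformulas-swapAt : ∀ a {b} (g : Subset (a + (2 + b))) P → oformulas (swapAt a g) (swapAt a P) ↭ oformulas g P
oformulas-swapAt a g P with splitAt₂ a g | splitAt₂ a P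
... | split u b₁ b₂ w | split U x y W = begin
  oformulas (swapAt a (u ++ᵛ b₁ ∷ b₂ ∷ w)) (swapAt a (U ++ᵛ x ∷ y ∷ W)) ≡⟨ cong₂ oformulas (swapAt-++ u) (swapAt-++ U) ⟩
  oformulas (u ++ᵛ b₂ ∷ b₁ ∷ w) (U ++ᵛ y ∷ x ∷ W)                        ≡⟨ oformulas-++ u U ⟩
  oformulas u U ++ oformulas (b₂ ∷ b₁ ∷ w) (y ∷ x ∷ W)                   ↭⟨ ++⁺ˡ (oformulas u U) (swap-heads b₁ b₂) ⟩
  oformulas u U ++ oformulas (b₁ ∷ b₂ ∷ w) (x ∷ y ∷ W)                   ≡⟨ oformulas-++ u U ⟨
  oformulas (u ++ᵛ b₁ ∷ b₂ ∷ w) (U ++ᵛ x ∷ y ∷ W)                        ∎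
  where
  open PermutationReasoning
  swap-heads : ∀ b₁ b₂ → oformulas (b₂ ∷ b₁ ∷ w) (y ∷ x ∷ W) ↭ oformulas (b₁ ∷ b₂ ∷ w) (x ∷ y ∷ W)
  swap-heads true  true  = swap y x ↭-refl
  swap-heads true  false = ↭-refl
  swap-heads false true  = ↭-refl
  swap-heads false false = ↭-refl

oformulas-mergeAt : ∀ {a b} (u : Subset a) (U : Vec Formula a) {h f b₁ b₂} {w : Subset b} {x y W} →
  oformulas (mergeAt a h (u ++ᵛ b₁ ∷ b₂ ∷ w)) (mergeAt a f (U ++ᵛ x ∷ y ∷ W)) ≡
  oformulas u U ++ oformulas (h b₁ b₂ ∷ w) (f x y ∷ W)
oformulas-mergeAt u U = trans (cong₂ oformulas (mergeAt-++ u) (mergeAt-++ U)) (oformulas-++ u U)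

local-admissible :
  ∀ a {b} {h : Bool → Bool → Bool} {f : Formula → Formula → Formula} (R : Bool × Bool → Formula × Formula → Set) →
  (∀ Θ b₁ b₂ {w : Subset b} {x y W} → R (b₁ , b₂) (x , y) →
     SeqProof k (Θ ++ oformulas (b₁ ∷ b₂ ∷ w) (x ∷ y ∷ W)) → SeqProof k (Θ ++ oformulas (h b₁ b₂ ∷ w) (f x y ∷ W))) →
  ∀ g P → R (pairAt a g) (pairAt a P) →
  SeqProof k (oformulas g P) → SeqProof k (oformulas (mergeAt a h g) (mergeAt a f P))
local-admissible a R step g P r ⊢ with splitAt₂ a g | splitAt₂ a P
... | split u b₁ b₂ w | split U x y W =
  subst (SeqProof _) (sym (oformulas-mergeAt u U))
    (step (oformulas u U) b₁ b₂ (subst₂ R (pairAt-++ u) (pairAt-++ U) r) (subst (SeqProof _) (oformulas-++ u U) ⊢))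

∨-step : ∀ Θ b₁ b₂ {w : Subset n} {x y W} →
         SeqProof k (Θ ++ oformulas (b₁ ∷ b₂ ∷ w) (x ∷ y ∷ W)) → SeqProof k (Θ ++ oformulas ((b₁ ∨ b₂) ∷ w) ((x ∨ᶠ y) ∷ W))
∨-step Θ true  true  ⊢ = ∨-intro Θ _ _ _ ⊢
∨-step Θ true  false ⊢ = ∨-intro Θ _ _ _ (exch Θ _ _ _ (weak Θ _ _ ⊢))
∨-step Θ false true  ⊢ = ∨-intro Θ _ _ _ (weak Θ _ _ ⊢)
∨-step Θ false false ⊢ = ⊢

contraction-step : k ≡ true → ∀ Θ b₁ b₂ {w : Subset n} {x y W} → x ≡ y →
                   SeqProof k (Θ ++ oformulas (b₁ ∷ b₂ ∷ w) (x ∷ y ∷ W)) → SeqProof k (Θ ++ oformulas ((b₁ ∨ b₂) ∷ w) (x ∷ W))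
contraction-step k≡true Θ true  true  refl ⊢ = contr Θ _ _ k≡true ⊢
contraction-step _      Θ true  false refl ⊢ = ⊢
contraction-step _      Θ false true  refl ⊢ = ⊢
contraction-step _      Θ false false refl ⊢ = ⊢

unmarked-step : ∀ Θ b₁ b₂ {w : Subset n} {x y W} → (b₁ , b₂) ≡ (false , false) →
                SeqProof k (Θ ++ oformulas (b₁ ∷ b₂ ∷ w) (x ∷ y ∷ W)) → SeqProof k (Θ ++ oformulas ((b₁ ∨ b₂) ∷ w) ((x ∧ᶠ y) ∷ W))
unmarked-step Θ false false refl ⊢ = ⊢

Empty-drop₂ : ∀ {a b} (u : Subset a) {w : Subset b} → Empty (u ++ᵛ false ∷ false ∷ w) → Empty (u ++ᵛ w)
Empty-drop₂ []      empty                       = drop-∷-Empty (drop-∷-Empty empty)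
Empty-drop₂ (_ ∷ u) empty (zero  , here)        = empty (zero , here)
Empty-drop₂ (_ ∷ u) empty (suc i , there i∈u++w) = Empty-drop₂ u (drop-∷-Empty empty) (i , i∈u++w)

∧-admissible : ∀ a {b} (g d : Subset (a + (2 + b))) P →
               pairAt a g ≡ (true , false) → pairAt a d ≡ (false , true) → k ≡ true ⊎ Empty (g ∩ d) →
               SeqProof k (oformulas g P) → SeqProof k (oformulas d P) →
               SeqProof k (oformulas (mergeAt a _∨_ (g ∪ d)) (mergeAt a _∧ᶠ_ P))
∧-admissible a g d P g-at d-at contr-or-disjoint ⊢g ⊢d with splitAt₂ a g | splitAt₂ a d | splitAt₂ a P
... | split u b₁ b₂ w | split u′ b₃ b₄ w′ | split U x y W
  with trans (sym (pairAt-++ u)) g-at | trans (sym (pairAt-++ u′)) d-at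
... | refl | refl = SeqProof-resp-↭ regroup (∪-admissible [ x ∧ᶠ y ] (u ++ᵛ w) (u′ ++ᵛ w′) (U ++ᵛ W) contr-or-disjoint′ ⊢x∧y)
  where
  open PermutationReasoning
  ⊢x∧y : SeqProof _ ((x ∧ᶠ y) ∷ oformulas (u ++ᵛ w) (U ++ᵛ W) ++ oformulas (u′ ++ᵛ w′) (U ++ᵛ W))
  ⊢x∧y = subst (SeqProof _) (sym (cong₂ (λ l r → (x ∧ᶠ y) ∷ l ++ r) (oformulas-++ u U) (oformulas-++ u′ U)))
           (∧-intro-inside (subst (SeqProof _) (oformulas-++ u U) ⊢g) (subst (SeqProof _) (oformulas-++ u′ U) ⊢d))
  contr-or-disjoint′ : _ ≡ true ⊎ Empty ((u ++ᵛ w) ∩ (u′ ++ᵛ w′))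
  contr-or-disjoint′ = map₂ (λ disjoint → subst Empty (sym (zipWith-++ _ u w u′ w′))
                              (Empty-drop₂ (u ∩ u′) (subst Empty (zipWith-++ _ u _ u′ _) disjoint))) contr-or-disjoint
  regroup : (x ∧ᶠ y) ∷ oformulas ((u ++ᵛ w) ∪ (u′ ++ᵛ w′)) (U ++ᵛ W) ↭
            oformulas (mergeAt a _∨_ ((u ++ᵛ true ∷ false ∷ w) ∪ (u′ ++ᵛ false ∷ true ∷ w′))) (mergeAt a _∧ᶠ_ (U ++ᵛ x ∷ y ∷ W))
  regroup = begin
    (x ∧ᶠ y) ∷ oformulas ((u ++ᵛ w) ∪ (u′ ++ᵛ w′)) (U ++ᵛ W)
      ≡⟨ cong (λ e → (x ∧ᶠ y) ∷ oformulas e (U ++ᵛ W)) (zipWith-++ _ u w u′ w′) ⟩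
    (x ∧ᶠ y) ∷ oformulas ((u ∪ u′) ++ᵛ (w ∪ w′)) (U ++ᵛ W)
      ≡⟨ cong ((x ∧ᶠ y) ∷_) (oformulas-++ (u ∪ u′) U) ⟩
    (x ∧ᶠ y) ∷ oformulas (u ∪ u′) U ++ oformulas (w ∪ w′) W
      ↭⟨ shift (x ∧ᶠ y) _ _ ⟨
    oformulas (u ∪ u′) U ++ oformulas (true ∷ (w ∪ w′)) ((x ∧ᶠ y) ∷ W)
      ≡⟨ oformulas-mergeAt (u ∪ u′) U ⟨
    oformulas (mergeAt a _∨_ ((u ∪ u′) ++ᵛ true ∷ true ∷ (w ∪ w′))) (mergeAt a _∧ᶠ_ (U ++ᵛ x ∷ y ∷ W))
      ≡⟨ cong (λ e → oformulas (mergeAt a _∨_ e) _) (zipWith-++ _ u _ u′ _) ⟨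
    oformulas (mergeAt a _∨_ ((u ++ᵛ true ∷ false ∷ w) ∪ (u′ ++ᵛ false ∷ true ∷ w′))) (mergeAt a _∧ᶠ_ (U ++ᵛ x ∷ y ∷ W)) ∎

join-admissible : ∀ a {b Γs Γs′} (P : Vec Formula (a + (2 + b))) → JoinAt a Γs Γs′ → k ≡ true ⊎ Primitive Γs →
                  All (λ g → SeqProof k (oformulas g P)) Γs →
                  All (λ g → SeqProof k (oformulas g (mergeAt a _∧ᶠ_ P))) (List.map (mergeAt a _∨_) Γs′)
join-admissible a P jnil _ [] = []
join-admissible a P (jskip {Γ} Γ-at j) contr-or-primitive (⊢Γ ∷ ⊢s) =
  local-admissible a (λ bs _ → bs ≡ (false , false)) unmarked-step Γ P Γ-at ⊢Γ
  ∷ join-admissible a P j (map₂ AllPairs.tail contr-or-primitive) ⊢s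
join-admissible a P (jpair {Γ} {Δ} Γ-at Δ-at j) contr-or-primitive (⊢Γ ∷ ⊢Δ ∷ ⊢s) =
  ∧-admissible a Γ Δ P Γ-at Δ-at (map₂ (All.head ∘ AllPairs.head) contr-or-primitive) ⊢Γ ⊢Δ
  ∷ join-admissible a P j (map₂ (AllPairs.tail ∘ AllPairs.tail) contr-or-primitive) ⊢s

conclusion-primitive : ∀ {Γs} {P : Vec Formula n} → CirqProof k true n Γs P → Primitive Γs
conclusion-primitive (axEmpty o)           = o
conclusion-primitive (axNeg _ o)           = o
conclusion-primitive (mix _ _ o)           = o
conclusion-primitive (exchF _ _ o)         = o
conclusion-primitive (exchG _ _ _ _ _ o)   = o
conclusion-primitive (weakG _ _ _ _ _ o)   = o
conclusion-primitive (weakF _ _ _ o)       = o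
conclusion-primitive (dupDown _ _ _ _ o)   = o
conclusion-primitive (dupUp _ _ _ _ o)     = o
conclusion-primitive (contr _ _ _ _ o)     = o
conclusion-primitive (∨-intro _ _ o)       = o
conclusion-primitive (∧-intro _ _ _ o)     = o

All-inside : ∀ {P : A → Set} Xs {Ys Zs} → (All P Ys → All P Zs) → All P (Xs ++ Ys) → All P (Xs ++ Zs)
All-inside Xs f all with ++⁻ Xs all
... | allXs , allYs = ++⁺ allXs (f allYs)

ogroups-provable : ∀ {Γs} {P : Vec Formula n} → k ≡ true ⊎ s ≡ true → CirqProof k s n Γs P →
                   All (λ g → SeqProof k (oformulas g P)) Γs
ogroups-provable contr-or-star (axEmpty _)   = []
ogroups-provable contr-or-star (axNeg F _)   = axiom F ∷ []
ogroups-provable contr-or-star (mix {P = P} ⊢Γs ⊢Δs _) =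
  ++⁺ (map⁺ (All.map (λ {g} → subst (SeqProof _) (sym (oformulas-padʳ g P))) (ogroups-provable contr-or-star ⊢Γs)))
      (map⁺ (All.map (λ {d} → subst (SeqProof _) (sym (oformulas-padˡ d P))) (ogroups-provable contr-or-star ⊢Δs)))
ogroups-provable contr-or-star (exchF a {P = P} ⊢ _) =
  map⁺ (All.map (λ {g} → SeqProof-resp-↭ (↭-sym (oformulas-swapAt a g P))) (ogroups-provable contr-or-star ⊢))
ogroups-provable contr-or-star (exchG Γs _ _ _ ⊢ _) =
  All-inside Γs (λ { (⊢Γ ∷ ⊢Δ ∷ ⊢s) → ⊢Δ ∷ ⊢Γ ∷ ⊢s }) (ogroups-provable contr-or-star ⊢)
ogroups-provable contr-or-star (weakG Γs Γ _ i ⊢ _) =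
  All-inside Γs (λ { (⊢Γ ∷ ⊢s) → weaken-⊆ (oformulas-mono (q⊆p∪q ⁅ i ⁆ Γ)) ⊢Γ ∷ ⊢s }) (ogroups-provable contr-or-star ⊢)
ogroups-provable contr-or-star (weakF {P = P} i _ ⊢ _) =
  map⁺ (All.map (λ {g} → subst (SeqProof _) (sym (oformulas-insertAt g P i))) (ogroups-provable contr-or-star ⊢))
ogroups-provable contr-or-star (dupDown Γs _ _ ⊢ _) =
  All-inside Γs (λ { (⊢Γ ∷ ⊢s) → ⊢Γ ∷ ⊢Γ ∷ ⊢s }) (ogroups-provable contr-or-star ⊢)
ogroups-provable contr-or-star (dupUp Γs _ _ ⊢ _) =
  All-inside Γs (λ { (⊢Γ ∷ _ ∷ ⊢s) → ⊢Γ ∷ ⊢s }) (ogroups-provable contr-or-star ⊢)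
ogroups-provable contr-or-star (contr a {P = P} k≡true x≡y ⊢ _) =
  map⁺ (All.map (λ {g} → local-admissible a (λ _ → uncurry _≡_) (contraction-step k≡true) g P x≡y)
                (ogroups-provable contr-or-star ⊢))
ogroups-provable contr-or-star (∨-intro a {P = P} ⊢ _) =
  map⁺ (All.map (λ {g} → local-admissible a (λ _ _ → Unit.⊤) (λ Θ b₁ b₂ _ → ∨-step Θ b₁ b₂) g P Unit.tt) (ogroups-provable contr-or-star ⊢))
ogroups-provable contr-or-star (∧-intro a {P = P} ⊢ join _) =
  join-admissible a P join (map₂ (λ { refl → conclusion-primitive ⊢ }) contr-or-star) (ogroups-provable contr-or-star ⊢)

cirquent→sequent : ∀ {F} → k ≡ true ⊎ s ≡ true → CirqProves k s F → SeqProof k (F ∷ [])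
cirquent→sequent contr-or-star ⊢ = All.head (ogroups-provable contr-or-star ⊢)

forget-primitivity : ∀ {Γs} {P : Vec Formula n} → CirqProof k true n Γs P → CirqProof k false n Γs P
forget-primitivity (axEmpty _)              = axEmpty Unit.tt
forget-primitivity (axNeg F _)              = axNeg F Unit.tt
forget-primitivity (mix ⊢Γs ⊢Δs _)          = mix (forget-primitivity ⊢Γs) (forget-primitivity ⊢Δs) Unit.tt
forget-primitivity (exchF a ⊢ _)            = exchF a (forget-primitivity ⊢) Unit.tt
forget-primitivity (exchG Γs Γ Δ Δs ⊢ _)    = exchG Γs Γ Δ Δs (forget-primitivity ⊢) Unit.tt
forget-primitivity (weakG Γs Γ Δs i ⊢ _)    = weakG Γs Γ Δs i (forget-primitivity ⊢) Unit.tt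
forget-primitivity (weakF i F ⊢ _)          = weakF i F (forget-primitivity ⊢) Unit.tt
forget-primitivity (dupDown Γs Γ Δs ⊢ _)    = dupDown Γs Γ Δs (forget-primitivity ⊢) Unit.tt
forget-primitivity (dupUp Γs Γ Δs ⊢ _)      = dupUp Γs Γ Δs (forget-primitivity ⊢) Unit.tt
forget-primitivity (contr a k≡true x≡y ⊢ _) = contr a k≡true x≡y (forget-primitivity ⊢) Unit.tt
forget-primitivity (∨-intro a ⊢ _)          = ∨-intro a (forget-primitivity ⊢) Unit.tt
forget-primitivity (∧-intro a ⊢ join _)     = ∧-intro a (forget-primitivity ⊢) join Unit.tt

-- Sequents as primitive cirquents

Star⊢ : Bool → List Formula → Set
Star⊢ k Γ = CirqProof k true (List.length Γ) (⊤ ∷ []) (fromList Γ)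

toList-length : {P : Vec A m} {Q : Vec A n} → toList P ≡ toList Q → m ≡ n
toList-length {P = P} {Q} P≡Q = trans (sym (length-toList P)) (trans (cong List.length P≡Q) (length-toList Q))

toList-injective′ : {P Q : Vec A n} → toList P ≡ toList Q → P ≡ Q
toList-injective′ {P = P} {Q} P≡Q = trans (sym (cast-is-id refl P)) (toList-injective refl P Q P≡Q)

-- Cirquents are compared through the lists underlying their vectors, which avoids equations
-- between vector lengths such as List.length (Γ ++ Δ) ≡ List.length Γ + List.length Δ.
reindex : ∀ {Γs : List (Subset m)} {Δs : List (Subset n)} {P Q} →
          List.map toList Γs ≡ List.map toList Δs → toList P ≡ toList Q →
          CirqProof k s m Γs P → CirqProof k s n Δs Q
reindex {P = P} {Q} Γs≡Δs P≡Q ⊢ with toList-length {P = P} {Q} P≡Q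
... | refl = subst₂ (CirqProof _ _ _) (map-injective toList-injective′ Γs≡Δs) (toList-injective′ P≡Q) ⊢

reindex-one : ∀ {g : Subset m} {P : Vec Formula m} {Q : Vec Formula n} → g ≡ ⊤ → toList P ≡ toList Q →
              CirqProof k s m (g ∷ []) P → CirqProof k s n (⊤ ∷ []) Q
reindex-one {P = P} {Q} refl P≡Q = reindex (cong (λ n → toList (⊤ {n}) ∷ []) (toList-length {P = P} {Q} P≡Q)) P≡Q

⟪_∣_∣_⟫ : ∀ Γ → Vec Formula n → ∀ Δ → Vec Formula (List.length Γ + (n + List.length Δ))
⟪ Γ ∣ v ∣ Δ ⟫ = fromList Γ ++ᵛ v ++ᵛ fromList Δ

toList-⟪⟫ : ∀ Γ (v : Vec Formula n) Δ → toList ⟪ Γ ∣ v ∣ Δ ⟫ ≡ Γ ++ toList v ++ Δ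
toList-⟪⟫ Γ v Δ = begin
  toList (fromList Γ ++ᵛ v ++ᵛ fromList Δ)                ≡⟨ toList-++ (fromList Γ) _ ⟩
  toList (fromList Γ) ++ toList (v ++ᵛ fromList Δ)         ≡⟨ cong (toList (fromList Γ) ++_) (toList-++ v _) ⟩
  toList (fromList Γ) ++ toList v ++ toList (fromList Δ)   ≡⟨ cong₂ (λ l r → l ++ toList v ++ r) (toList∘fromList Γ) (toList∘fromList Δ) ⟩
  Γ ++ toList v ++ Δ                                       ∎
  where open ≡-Reasoning

focus : ∀ Γ (v : Vec Formula n) Δ → Star⊢ k (Γ ++ toList v ++ Δ) → CirqProof k true _ (⊤ ∷ []) ⟪ Γ ∣ v ∣ Δ ⟫
focus Γ v Δ = reindex-one refl (trans (toList∘fromList _) (sym (toList-⟪⟫ Γ v Δ)))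

unfocus : ∀ Γ (v : Vec Formula n) Δ {g : Subset m} {Q} → g ≡ ⊤ → toList Q ≡ toList ⟪ Γ ∣ v ∣ Δ ⟫ →
          CirqProof k true m (g ∷ []) Q → Star⊢ k (Γ ++ toList v ++ Δ)
unfocus Γ v Δ g≡⊤ Q≡ = reindex-one g≡⊤ (trans Q≡ (trans (toList-⟪⟫ Γ v Δ) (sym (toList∘fromList _))))

swapAt-⊤ : ∀ a {b} → swapAt a (⊤ {a + (2 + b)}) ≡ ⊤
swapAt-⊤ zero    = refl
swapAt-⊤ (suc a) = cong (true ∷_) (swapAt-⊤ a)

mergeAt-⊤ : ∀ a {b} → mergeAt a _∨_ (⊤ {a + (2 + b)}) ≡ ⊤
mergeAt-⊤ zero    = refl
mergeAt-⊤ (suc a) = cong (true ∷_) (mergeAt-⊤ a)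

⁅⁆∪insertAt-⊤ : (i : Fin (suc n)) → ⁅ i ⁆ ∪ insertAt ⊤ i false ≡ ⊤
⁅⁆∪insertAt-⊤ zero                = cong (true ∷_) (∪-identityˡ ⊤)
⁅⁆∪insertAt-⊤ {n = suc n} (suc i) = cong (true ∷_) (⁅⁆∪insertAt-⊤ i)

toList-insertAt-++ : ∀ (u : Vec A m) {v : Vec A n} {x} →
                     toList (insertAt (u ++ᵛ v) (fromℕ m ↑ˡ n) x) ≡ toList (u ++ᵛ x ∷ v)
toList-insertAt-++ []      = refl
toList-insertAt-++ (y ∷ u) = cong (y ∷_) (toList-insertAt-++ u)

exch-star : ∀ Γ F G Δ → Star⊢ k (Γ ++ F ∷ G ∷ Δ) → Star⊢ k (Γ ++ G ∷ F ∷ Δ)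
exch-star Γ F G Δ ⊢ =
  unfocus Γ (G ∷ F ∷ []) Δ (swapAt-⊤ (List.length Γ)) (cong toList (swapAt-++ (fromList Γ)))
    (exchF (List.length Γ) (focus Γ (F ∷ G ∷ []) Δ ⊢) ([] ∷ []))

weak-star : ∀ Γ F Δ → Star⊢ k (Γ ++ Δ) → Star⊢ k (Γ ++ F ∷ Δ)
weak-star Γ F Δ ⊢ =
  unfocus Γ (F ∷ []) Δ (⁅⁆∪insertAt-⊤ i) (toList-insertAt-++ (fromList Γ))
    (weakG [] _ [] i (weakF i F (focus Γ [] Δ ⊢) ([] ∷ [])) ([] ∷ []))
  where
  i : Fin (suc (List.length Γ + List.length Δ))
  i = fromℕ (List.length Γ) ↑ˡ List.length Δ

contr-star : k ≡ true → ∀ Γ F Δ → Star⊢ k (Γ ++ F ∷ F ∷ Δ) → Star⊢ k (Γ ++ F ∷ Δ)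
contr-star k≡true Γ F Δ ⊢ =
  unfocus Γ (F ∷ []) Δ (mergeAt-⊤ (List.length Γ)) (cong toList (mergeAt-++ (fromList Γ)))
    (contr (List.length Γ) k≡true (subst (uncurry _≡_) (sym (pairAt-++ (fromList Γ))) refl)
      (focus Γ (F ∷ F ∷ []) Δ ⊢) ([] ∷ []))

∨-star : ∀ Γ F G Δ → Star⊢ k (Γ ++ F ∷ G ∷ Δ) → Star⊢ k (Γ ++ (F ∨ᶠ G) ∷ Δ)
∨-star Γ F G Δ ⊢ =
  unfocus Γ ((F ∨ᶠ G) ∷ []) Δ (mergeAt-⊤ (List.length Γ)) (cong toList (mergeAt-++ (fromList Γ)))
    (∨-intro (List.length Γ) (focus Γ (F ∷ G ∷ []) Δ ⊢) ([] ∷ []))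

toList-fromList-∷ʳ : ∀ Γ {F} (v : Vec Formula n) → toList (fromList (Γ ++ [ F ]) ++ᵛ v) ≡ toList (fromList Γ ++ᵛ F ∷ v)
toList-fromList-∷ʳ []      v = refl
toList-fromList-∷ʳ (G ∷ Γ) v = cong (G ∷_) (toList-fromList-∷ʳ Γ v)

toList-replicate-∷ʳ : ∀ (Γ : List Formula) {F} (x : A) (v : Vec A n) →
                      toList (replicate (List.length (Γ ++ [ F ])) x ++ᵛ v) ≡ toList (replicate (List.length Γ) x ++ᵛ x ∷ v)
toList-replicate-∷ʳ []      x v = refl
toList-replicate-∷ʳ (G ∷ Γ) x v = cong (x ∷_) (toList-replicate-∷ʳ Γ x v)

⊤++⊥-disjoint : Empty ((⊤ {m} ++ᵛ ⊥ {n}) ∩ (⊥ {m} ++ᵛ ⊤ {n}))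
⊤++⊥-disjoint {zero}  (i , i∈⊥∩⊤)      = ∉⊥ (subst (i ∈_) (∩-zeroˡ ⊤) i∈⊥∩⊤)
⊤++⊥-disjoint {suc m} (suc i , there i∈) = ⊤++⊥-disjoint {m} (i , i∈)

joined-⊤ : ∀ a {b} → mergeAt a _∨_ ((⊤ {a} ++ᵛ true ∷ false ∷ ⊥ {b}) ∪ (⊥ ++ᵛ false ∷ true ∷ ⊤)) ≡ ⊤
joined-⊤ zero    = cong (true ∷_) (∪-identityˡ ⊤)
joined-⊤ (suc a) = cong (true ∷_) (joined-⊤ a)

∧-star : ∀ Γ F G Δ → Star⊢ k (Γ ++ [ F ]) → Star⊢ k (G ∷ Δ) → Star⊢ k (Γ ++ (F ∧ᶠ G) ∷ Δ)
∧-star Γ F G Δ ⊢F ⊢G =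
  unfocus Γ ((F ∧ᶠ G) ∷ []) Δ (joined-⊤ (List.length Γ)) (cong toList (mergeAt-++ (fromList Γ)))
    (∧-intro (List.length Γ) mixed (jpair (pairAt-++ (⊤ {List.length Γ})) (pairAt-++ (⊥ {List.length Γ})) jnil) ([] ∷ []))
  where
  mixed : CirqProof _ true _ ((⊤ ++ᵛ true ∷ false ∷ ⊥) ∷ (⊥ ++ᵛ false ∷ true ∷ ⊤) ∷ []) ⟪ Γ ∣ F ∷ G ∷ [] ∣ Δ ⟫
  mixed = reindex (cong₂ (λ l r → l ∷ r ∷ []) (toList-replicate-∷ʳ Γ {F} true _) (toList-replicate-∷ʳ Γ {F} false _))
                  (toList-fromList-∷ʳ Γ {F} _)
                  (mix ⊢F ⊢G ((⊤++⊥-disjoint {List.length (Γ ++ [ F ])} ∷ []) ∷ [] ∷ []))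

sequent→star : SeqProof k Γ → Star⊢ k Γ
sequent→star (axiom F)              = axNeg F ([] ∷ [])
sequent→star (exch Γ F G Δ ⊢)       = exch-star Γ F G Δ (sequent→star ⊢)
sequent→star (weak Γ F Δ ⊢)         = weak-star Γ F Δ (sequent→star ⊢)
sequent→star (contr Γ F Δ k≡true ⊢) = contr-star k≡true Γ F Δ (sequent→star ⊢)
sequent→star (∨-intro Γ F G Δ ⊢)    = ∨-star Γ F G Δ (sequent→star ⊢)
sequent→star (∧-intro Γ F G Δ ⊢F ⊢G) = ∧-star Γ F G Δ (sequent→star ⊢F) (sequent→star ⊢G)

-- Models of affine logic

record AffineModel : Set₁ where
  infixr 5 _⅋_
  field
    Carrier             : Set
    _⅋_                 : Carrier → Carrier → Carrier
    ⊥ᵐ ⊤ᵐ               : Carrier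
    dual                : Carrier → Carrier
    isCommutativeMonoid : IsCommutativeMonoid _≡_ _⅋_ ⊥ᵐ
    zeroʳ               : RightZero _≡_ ⊤ᵐ _⅋_
    dual-involutive     : Involutive _≡_ dual
    dual-⅋-⊤            : ∀ x → dual x ⅋ x ≡ ⊤ᵐ
    ⊗-⊤                 : ∀ x y γ δ → x ⅋ γ ≡ ⊤ᵐ → y ⅋ δ ≡ ⊤ᵐ → dual (dual x ⅋ dual y) ⅋ γ ⅋ δ ≡ ⊤ᵐ

module _ (𝓜 : AffineModel) (ρ : ℕ → AffineModel.Carrier 𝓜) where
  open AffineModel 𝓜
  open IsCommutativeMonoid isCommutativeMonoid using (assoc; identityˡ; identityʳ; isCommutativeSemigroup)

  ⅋-commutativeSemigroup : CommutativeSemigroup _ _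
  ⅋-commutativeSemigroup = record { isCommutativeSemigroup = isCommutativeSemigroup }

  open import Algebra.Properties.CommutativeSemigroup ⅋-commutativeSemigroup using (x∙yz≈y∙xz)
  open ≡-Reasoning

  ⟦_⟧ : Formula → Carrier
  ⟦ atom n ⟧    = ρ n
  ⟦ negatom n ⟧ = dual (ρ n)
  ⟦ F ∧ᶠ G ⟧    = dual (dual ⟦ F ⟧ ⅋ dual ⟦ G ⟧)
  ⟦ F ∨ᶠ G ⟧    = ⟦ F ⟧ ⅋ ⟦ G ⟧

  ⟦_⟧ˢ : List Formula → Carrier
  ⟦_⟧ˢ = List.foldr (λ F v → ⟦ F ⟧ ⅋ v) ⊥ᵐ

  ⟦~⟧ : ∀ F → ⟦ ~ F ⟧ ≡ dual ⟦ F ⟧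
  ⟦~⟧ (atom n)    = refl
  ⟦~⟧ (negatom n) = sym (dual-involutive (ρ n))
  ⟦~⟧ (F ∧ᶠ G)    = trans (cong₂ _⅋_ (⟦~⟧ F) (⟦~⟧ G)) (sym (dual-involutive _))
  ⟦~⟧ (F ∨ᶠ G)    = cong dual (cong₂ _⅋_ (trans (cong dual (⟦~⟧ F)) (dual-involutive _))
                                         (trans (cong dual (⟦~⟧ G)) (dual-involutive _)))

  ⟦++⟧ : ∀ Γ Δ → ⟦ Γ ++ Δ ⟧ˢ ≡ ⟦ Γ ⟧ˢ ⅋ ⟦ Δ ⟧ˢ
  ⟦++⟧ []      Δ = sym (identityˡ _)
  ⟦++⟧ (F ∷ Γ) Δ = trans (cong (⟦ F ⟧ ⅋_) (⟦++⟧ Γ Δ)) (sym (assoc _ _ _))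

  ⟦++∷⟧ : ∀ Γ F Δ → ⟦ Γ ++ F ∷ Δ ⟧ˢ ≡ ⟦ F ⟧ ⅋ ⟦ Γ ++ Δ ⟧ˢ
  ⟦++∷⟧ Γ F Δ = begin
    ⟦ Γ ++ F ∷ Δ ⟧ˢ          ≡⟨ ⟦++⟧ Γ (F ∷ Δ) ⟩
    ⟦ Γ ⟧ˢ ⅋ ⟦ F ⟧ ⅋ ⟦ Δ ⟧ˢ   ≡⟨ x∙yz≈y∙xz _ _ _ ⟩
    ⟦ F ⟧ ⅋ ⟦ Γ ⟧ˢ ⅋ ⟦ Δ ⟧ˢ   ≡⟨ cong (⟦ F ⟧ ⅋_) (⟦++⟧ Γ Δ) ⟨
    ⟦ F ⟧ ⅋ ⟦ Γ ++ Δ ⟧ˢ       ∎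

  affine-sound : SeqProof false Γ → ⟦ Γ ⟧ˢ ≡ ⊤ᵐ
  affine-sound (axiom F) = trans (cong₂ _⅋_ (⟦~⟧ F) (identityʳ _)) (dual-⅋-⊤ _)
  affine-sound (exch Γ F G Δ ⊢) = begin
    ⟦ Γ ++ G ∷ F ∷ Δ ⟧ˢ           ≡⟨ ⟦++∷⟧ Γ G (F ∷ Δ) ⟩
    ⟦ G ⟧ ⅋ ⟦ Γ ++ F ∷ Δ ⟧ˢ       ≡⟨ cong (⟦ G ⟧ ⅋_) (⟦++∷⟧ Γ F Δ) ⟩
    ⟦ G ⟧ ⅋ ⟦ F ⟧ ⅋ ⟦ Γ ++ Δ ⟧ˢ   ≡⟨ x∙yz≈y∙xz _ _ _ ⟩
    ⟦ F ⟧ ⅋ ⟦ G ⟧ ⅋ ⟦ Γ ++ Δ ⟧ˢ   ≡⟨ cong (⟦ F ⟧ ⅋_) (⟦++∷⟧ Γ G Δ) ⟨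
    ⟦ F ⟧ ⅋ ⟦ Γ ++ G ∷ Δ ⟧ˢ       ≡⟨ ⟦++∷⟧ Γ F (G ∷ Δ) ⟨
    ⟦ Γ ++ F ∷ G ∷ Δ ⟧ˢ           ≡⟨ affine-sound ⊢ ⟩
    ⊤ᵐ                             ∎
  affine-sound (weak Γ F Δ ⊢) = begin
    ⟦ Γ ++ F ∷ Δ ⟧ˢ       ≡⟨ ⟦++∷⟧ Γ F Δ ⟩
    ⟦ F ⟧ ⅋ ⟦ Γ ++ Δ ⟧ˢ   ≡⟨ cong (⟦ F ⟧ ⅋_) (affine-sound ⊢) ⟩
    ⟦ F ⟧ ⅋ ⊤ᵐ            ≡⟨ zeroʳ _ ⟩
    ⊤ᵐ                     ∎
  affine-sound (contr _ _ _ () _)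
  affine-sound (∨-intro Γ F G Δ ⊢) = begin
    ⟦ Γ ++ (F ∨ᶠ G) ∷ Δ ⟧ˢ           ≡⟨ ⟦++∷⟧ Γ (F ∨ᶠ G) Δ ⟩
    (⟦ F ⟧ ⅋ ⟦ G ⟧) ⅋ ⟦ Γ ++ Δ ⟧ˢ    ≡⟨ assoc _ _ _ ⟩
    ⟦ F ⟧ ⅋ ⟦ G ⟧ ⅋ ⟦ Γ ++ Δ ⟧ˢ      ≡⟨ cong (⟦ F ⟧ ⅋_) (⟦++∷⟧ Γ G Δ) ⟨
    ⟦ F ⟧ ⅋ ⟦ Γ ++ G ∷ Δ ⟧ˢ          ≡⟨ ⟦++∷⟧ Γ F (G ∷ Δ) ⟨
    ⟦ Γ ++ F ∷ G ∷ Δ ⟧ˢ              ≡⟨ affine-sound ⊢ ⟩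
    ⊤ᵐ                                ∎
  affine-sound (∧-intro Γ F G Δ ⊢F ⊢G) = begin
    ⟦ Γ ++ (F ∧ᶠ G) ∷ Δ ⟧ˢ              ≡⟨ ⟦++∷⟧ Γ (F ∧ᶠ G) Δ ⟩
    ⟦ F ∧ᶠ G ⟧ ⅋ ⟦ Γ ++ Δ ⟧ˢ            ≡⟨ cong (⟦ F ∧ᶠ G ⟧ ⅋_) (⟦++⟧ Γ Δ) ⟩
    ⟦ F ∧ᶠ G ⟧ ⅋ ⟦ Γ ⟧ˢ ⅋ ⟦ Δ ⟧ˢ         ≡⟨ ⊗-⊤ _ _ _ _ F-Γ (affine-sound ⊢G) ⟩
    ⊤ᵐ                                   ∎
    where
    F-Γ : ⟦ F ⟧ ⅋ ⟦ Γ ⟧ˢ ≡ ⊤ᵐ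
    F-Γ = begin
      ⟦ F ⟧ ⅋ ⟦ Γ ⟧ˢ        ≡⟨ cong (λ Γ′ → ⟦ F ⟧ ⅋ ⟦ Γ′ ⟧ˢ) (++-identityʳ Γ) ⟨
      ⟦ F ⟧ ⅋ ⟦ Γ ++ [] ⟧ˢ  ≡⟨ ⟦++∷⟧ Γ F [] ⟨
      ⟦ Γ ++ [ F ] ⟧ˢ        ≡⟨ affine-sound ⊢F ⟩
      ⊤ᵐ                     ∎

-- Blass's formula

-- Encoded in Fin 6 so that the laws of the model are decided by exhaustive search. Only top is
-- designated; pair, the value of p ∨ p, becomes designated next to any nonempty sequent, but both
-- conjunctions of Blass's formula take the value pair⁻, and pair⁻ ⅋ pair⁻ = pair.
Six : Set
Six = Fin 6

pattern unit  = zero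
pattern top   = suc zero
pattern atm   = suc (suc zero)
pattern atm⁻  = suc (suc (suc zero))
pattern pair  = suc (suc (suc (suc zero)))
pattern pair⁻ = suc (suc (suc (suc (suc zero))))

infixr 5 _⅋₆_
_⅋₆_ : Six → Six → Six
unit ⅋₆ y    = y
x    ⅋₆ unit = x
top  ⅋₆ _    = top
_    ⅋₆ top  = top
pair ⅋₆ _    = top
_    ⅋₆ pair = top
atm  ⅋₆ atm⁻ = top
atm⁻ ⅋₆ atm  = top
_    ⅋₆ _    = pair

dual₆ : Six → Six
dual₆ unit  = top
dual₆ top   = unit
dual₆ atm   = atm⁻
dual₆ atm⁻  = atm
dual₆ pair  = pair⁻
dual₆ pair⁻ = pair

six : AffineModel
six = record
  { Carrier             = Six
  ; _⅋_                 = _⅋₆_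
  ; ⊥ᵐ                  = unit
  ; ⊤ᵐ                  = top
  ; dual                = dual₆
  ; isCommutativeMonoid = record
    { isMonoid = record
      { isSemigroup = record
        { isMagma = isMagma _⅋₆_
        ; assoc   = from-yes (all? λ x → all? λ y → all? λ z → (x ⅋₆ y) ⅋₆ z ≟ x ⅋₆ y ⅋₆ z)
        }
      ; identity = (λ _ → refl) , from-yes (all? λ x → x ⅋₆ unit ≟ x)
      }
    ; comm = from-yes (all? λ x → all? λ y → x ⅋₆ y ≟ y ⅋₆ x)
    }
  ; zeroʳ               = from-yes (all? λ x → x ⅋₆ top ≟ top)
  ; dual-involutive     = from-yes (all? λ x → dual₆ (dual₆ x) ≟ x)
  ; dual-⅋-⊤            = from-yes (all? λ x → dual₆ x ⅋₆ x ≟ top)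
  ; ⊗-⊤                 = from-yes (all? λ x → all? λ y → all? λ γ → all? λ δ →
                            (x ⅋₆ γ ≟ top) →-dec (y ⅋₆ δ ≟ top) →-dec (dual₆ (dual₆ x ⅋₆ dual₆ y) ⅋₆ γ ⅋₆ δ ≟ top))
  }

blass : Formula
blass = ((¬p ∨ᶠ ¬p) ∧ᶠ (¬p ∨ᶠ ¬p)) ∨ᶠ ((p ∨ᶠ p) ∧ᶠ (p ∨ᶠ p))
  where
  p ¬p : Formula
  p  = atom 0
  ¬p = negatom 0

blass-not-affine : ¬ AffineLogic blass
blass-not-affine ⊢ with affine-sound six (λ _ → atm) ⊢
... | ()

-- Both ∧-introductions unite two ogroups sharing an oformula, which no sequent proof can imitate
-- without contraction.
blass-CL5 : CL5 blass
blass-CL5 = ∨-intro 0 (∧-intro 1 (∧-intro 0 regrouped (jpair refl refl (jpair refl refl jnil)) Unit.tt)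
                                  (jpair refl refl jnil) Unit.tt) Unit.tt
  where
  axiom-p : CirqProof false false 2 ((true ∷ true ∷ []) ∷ []) (negatom 0 ∷ atom 0 ∷ [])
  axiom-p = axNeg (atom 0) Unit.tt

  regrouped : CirqProof false false 4
    ((true ∷ false ∷ true ∷ false ∷ []) ∷ (false ∷ true ∷ true ∷ false ∷ []) ∷
     (true ∷ false ∷ false ∷ true ∷ []) ∷ (false ∷ true ∷ false ∷ true ∷ []) ∷ [])
    ((negatom 0 ∨ᶠ negatom 0) ∷ (negatom 0 ∨ᶠ negatom 0) ∷ (atom 0 ∨ᶠ atom 0) ∷ (atom 0 ∨ᶠ atom 0) ∷ [])
  regrouped =
    exchG (_ ∷ []) _ _ (_ ∷ [])
      (∨-intro 3 (∨-intro 2 (∨-intro 1 (∨-intro 0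
        (exchF 5 (exchF 3 (exchF 4 (exchF 5 (exchF 2 (exchF 3 (exchF 1
          (mix (mix axiom-p axiom-p Unit.tt) (mix axiom-p axiom-p Unit.tt) Unit.tt)
          Unit.tt) Unit.tt) Unit.tt) Unit.tt) Unit.tt) Unit.tt) Unit.tt)
        Unit.tt) Unit.tt) Unit.tt) Unit.tt) Unit.tt

theorem5p2 : ((AffineLogic ≐ CL5*) × (CL5* ⊑ CL5) × ¬ (CL5 ≐ AffineLogic))
    × ((ClassicalLogic ≐ CCC*) × (CCC* ⊑ CCC) × (CCC ≐ ClassicalLogic))
theorem5p2 =
  ( (λ F → mk⇔ sequent→star (cirquent→sequent (inj₂ refl)))
  , (λ F → forget-primitivity)
  , (λ CL5≐Affine → blass-not-affine (Equivalence.to (CL5≐Affine blass) blass-CL5)) )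
  , ( (λ F → mk⇔ sequent→star (cirquent→sequent (inj₁ refl)))
    , (λ F → forget-primitivity)
    , (λ F → mk⇔ (cirquent→sequent (inj₁ refl)) (forget-primitivity ∘ sequent→star)) )
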